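{- A partition $\lambda$ is triangular if and only if $\operatorname{Conv}(\lambda)\cap\operatorname{Conv}(\mathbb{N}^2\setminus\lambda)=\emptyset$.
   Context: $\mathbb{N}$ denotes the set of positive integers. A partition $\lambda=\lambda_1\lambda_2\dots\lambda_k$ (a weakly decreasing finite sequence of positive integers, possibly empty) is identified with its Ferrers diagram $\{(a,b)\in\mathbb{N}^2: 1\le b\le k,\ 1\le a\le\lambda_b\}$; its complement is $\mathbb{N}^2\setminus\lambda$. A partition is triangular if there exist real $r,s>0$ such that $\lambda$ is exactly the set of points of $\mathbb{N}^2$ lying on or below the line $x/r+y/s=1$ (equivalently $\lambda_j=\lfloor r-jr/s\rfloor$ for $1\le j\le k$ and $k=\lfloor s-s/r\rfloor$). $\operatorname{Conv}(S)$ denotes the convex hull of $S\subseteq\mathbb{R}^2$.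
   Formalization: The parameters r, s defining triangularity are taken in ℚ instead of ℝ, and the convex hulls consist of points with rational coordinates formed with rational weights. -}

module Defs where

open import Data.Nat as ℕ using (ℕ; zero; suc; _≥_)
open import Data.Product using (Σ; _×_; _,_)
open import Data.List using (List; []; _∷_; map; sum)
open import Data.List.Relation.Unary.All using (All)
open import Data.List.Relation.Unary.Linked using (Linked)
open import Data.Integer as ℤ using (ℤ)
open import Data.Rational as ℚ using (ℚ; Positive; 0ℚ; 1ℚ)
open import Data.Rational.Properties using (pos⇒nonZero)
open import Relation.Binary.PropositionalEquality using (_≡_)
open import Relation.Nullary using (¬_)
open import Data.Empty using (⊥)

IsPartition : List ℕ → Set
IsPartition λs = All (λ x → 1 ℕ.≤ x) λs × Linked _≥_ λs

-- part λs j = λ_j for 1 ≤ j ≤ k (1-indexed), and 0 otherwise.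
part : List ℕ → ℕ → ℕ
part _ zero = 0
part [] (suc _) = 0
part (x ∷ _) (suc zero) = x
part (_ ∷ xs) (suc (suc n)) = part xs (suc n)

-- Ferrers diagram: (a,b) ∈ λ iff 1 ≤ b ≤ k and 1 ≤ a ≤ λ_b.
-- (b ≤ k is implied by 1 ≤ a ≤ part λs b, as part is 0 beyond k.)
InDiagram : List ℕ → ℕ × ℕ → Set
InDiagram λs (a , b) = (1 ℕ.≤ a) × (1 ℕ.≤ b) × (a ℕ.≤ part λs b)

-- Complement N² \ λ (N = positive integers).
InComplement : List ℕ → ℕ × ℕ → Set
InComplement λs (a , b) = (1 ℕ.≤ a) × (1 ℕ.≤ b) × ¬ InDiagram λs (a , b)

toℚ : ℕ → ℚ
toℚ n = (ℤ.+ n) ℚ./ 1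

Point : Set
Point = ℚ × ℚ

Conv : (ℕ × ℕ → Set) → Point → Set
Conv S (x , y) =
  Σ (List ((ℕ × ℕ) × ℚ)) λ ws →
    All (λ { (p , w) → S p × (0ℚ ℚ.≤ w) }) ws
    × sum' (map (λ { (_ , w) → w }) ws) ≡ 1ℚ
    × sum' (map (λ { ((a , _) , w) → w ℚ.* (toℚ a) }) ws) ≡ x
    × sum' (map (λ { ((_ , b) , w) → w ℚ.* (toℚ b) }) ws) ≡ y
  where
  sum' : List ℚ → ℚ
  sum' [] = 0ℚ
  sum' (q ∷ qs) = q ℚ.+ sum' qs

Triangular : List ℕ → Set
Triangular λs =
  Σ ℚ λ r → Σ ℚ λ s → Σ (Positive r) λ pr → Σ (Positive s) λ ps →
    (a b : ℕ) → 1 ℕ.≤ a → 1 ℕ.≤ b →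
      (InDiagram λs (a , b) →
         ((toℚ a) ℚ.÷ r) {{pos⇒nonZero r {{pr}}}}
           ℚ.+ ((toℚ b) ℚ.÷ s) {{pos⇒nonZero s {{ps}}}} ℚ.≤ 1ℚ)
      × (((toℚ a) ℚ.÷ r) {{pos⇒nonZero r {{pr}}}}
           ℚ.+ ((toℚ b) ℚ.÷ s) {{pos⇒nonZero s {{ps}}}} ℚ.≤ 1ℚ →
         InDiagram λs (a , b))

HullsDisjoint : List ℕ → Set
HullsDisjoint λs = (p : Point) → Conv (InDiagram λs) p → Conv (InComplement λs) p → ⊥

{-# OPTIONS --safe #-}
module Submission where

open import Defs
open import Data.Nat using (ℕ)
open import Data.List using (List; []; _∷_; map)
open import Data.List.Relation.Unary.All as All using (All; []; _∷_)
import Data.List.Relation.Unary.All.Properties as All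
open import Data.Product using (Σ; ∃; _×_; _,_; proj₁; proj₂; map₁)
open import Function.Base using (_∘_)
open import Function.Bundles using (_⇔_; mk⇔; Equivalence)
open import Relation.Binary.PropositionalEquality
open import Relation.Nullary using (yes; no; contradiction)

-- If λ = {a/r + b/s ≤ 1}, the linear form a/r + b/s is ≤ 1 on Conv(λ) and > 1 on the hull of
-- the complement. Conversely, it suffices to find positive integers U, V such that, for every
-- row i of λ and every row j, the last cell (λ_i, i) of row i has U a + V b smaller than the
-- first cell (λ_j + 1, j) outside λ in row j: then λ = {U a + V b ≤ C} with C the largest value
-- on the last cells. For i < j and i > j these conditions are lower bounds on V/U and on U/V,
-- and the mediant of the extreme ones solves them all unless some bound from i < j and some
-- bound from i′ > j′ multiply to at least 1. In that case an explicit integer combination of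
-- two cells of λ equals one of three cells of the complement, so the hulls meet.

module _ where
  import Data.Nat as ℕ
  import Data.Nat.Properties as ℕ
  import Data.Nat.Coprimality as Coprime
  import Data.Integer as ℤ
  import Data.Integer.Properties as ℤ
  open import Data.Rational as ℚ
    using (ℚ; mkℚ; 0ℚ; 1ℚ; _+_; _*_; _≤_; _<_; 1/_; Positive; NonNegative; positive; nonNegative)
  open import Data.Rational.Properties
  open import Data.Rational.Solver using (module +-*-Solver)
  open import Function.Construct.Composition using (_⇔-∘_)
  open import Function.Construct.Symmetry using (⇔-sym)

  private
    toℚ-≡-mkℚ : ∀ n → toℚ n ≡ mkℚ (ℤ.+ n) 0 (Coprime.sym (Coprime.1-coprimeTo n))
    toℚ-≡-mkℚ n = normalize-coprime (Coprime.sym (Coprime.1-coprimeTo n))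

  toℚ-+ : ∀ m n → toℚ (m ℕ.+ n) ≡ toℚ m + toℚ n
  toℚ-+ m n rewrite toℚ-≡-mkℚ m | toℚ-≡-mkℚ n | ℤ.*-identityʳ (ℤ.+ m) | ℤ.*-identityʳ (ℤ.+ n) = refl

  toℚ-* : ∀ m n → toℚ (m ℕ.* n) ≡ toℚ m * toℚ n
  toℚ-* m n rewrite toℚ-≡-mkℚ m | toℚ-≡-mkℚ n = cong (ℚ._/ 1) (ℤ.pos-* m n)

  toℚ-mono-≤ : ∀ {m n} → m ℕ.≤ n → toℚ m ≤ toℚ n
  toℚ-mono-≤ {m} {n} m≤n rewrite toℚ-≡-mkℚ m | toℚ-≡-mkℚ n =
    ℚ.*≤* (subst₂ ℤ._≤_ (sym (ℤ.*-identityʳ (ℤ.+ m))) (sym (ℤ.*-identityʳ (ℤ.+ n))) (ℤ.+≤+ m≤n))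

  toℚ-cancel-≤ : ∀ {m n} → toℚ m ≤ toℚ n → m ℕ.≤ n
  toℚ-cancel-≤ {m} {n} le rewrite toℚ-≡-mkℚ m | toℚ-≡-mkℚ n with le
  ... | ℚ.*≤* p with subst₂ ℤ._≤_ (ℤ.*-identityʳ (ℤ.+ m)) (ℤ.*-identityʳ (ℤ.+ n)) p
  ... | ℤ.+≤+ m≤n = m≤n

  toℚ-nonNeg : ∀ n → NonNegative (toℚ n)
  toℚ-nonNeg n = normalize-nonNeg n 1

  toℚ-pos : ∀ n → .{{ℕ.NonZero n}} → Positive (toℚ n)
  toℚ-pos n = normalize-pos n 1

  WeightedPoints : Set
  WeightedPoints = List ((ℕ × ℕ) × ℚ)

  totalWeight : WeightedPoints → ℚ
  totalWeight [] = 0ℚ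
  totalWeight ((_ , w) ∷ ws) = w + totalWeight ws

  moment : (ℕ × ℕ → ℚ) → WeightedPoints → ℚ
  moment f [] = 0ℚ
  moment f ((p , w) ∷ ws) = w * f p + moment f ws

  abscissa ordinate : ℕ × ℕ → ℚ
  abscissa (a , _) = toℚ a
  ordinate (_ , b) = toℚ b

  -- `Conv` adds up with a function local to its `where` block, which cannot be named;
  -- unifying against the unfolded type of `Conv` recovers the three sums it constrains.
  private
    fibre : {A : Set} {B : A → Set} → Σ A B ≡ Σ A B → A → Set
    fibre {B = B} _ = B

    equatedSums : {P : Set} {w x y w′ x′ y′ : ℚ} →
      (P × w ≡ w′ × x ≡ x′ × y ≡ y′) ≡ (P × w ≡ w′ × x ≡ x′ × y ≡ y′) → ℚ × ℚ × ℚ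
    equatedSums {w = w} {x} {y} _ = w , x , y

    convSums : (ℕ × ℕ → Set) → ℚ → ℚ → WeightedPoints → ℚ × ℚ × ℚ
    convSums S x y ws = equatedSums (refl {x = fibre (refl {x = Conv S (x , y)}) ws})

    convSums-≡ : ∀ S x y ws →
      convSums S x y ws ≡ (totalWeight ws , moment abscissa ws , moment ordinate ws)
    convSums-≡ S x y [] = refl
    convSums-≡ S x y ((p , w) ∷ ws) =
      cong (λ (W , X , Y) → w + W , w * abscissa p + X , w * ordinate p + Y) (convSums-≡ S x y ws)

  IsConvexCombination : (ℕ × ℕ → Set) → Point → WeightedPoints → Set
  IsConvexCombination S (x , y) ws =
    All (λ (p , w) → S p × 0ℚ ≤ w) ws
    × totalWeight ws ≡ 1ℚ × moment abscissa ws ≡ x × moment ordinate ws ≡ y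

  Conv⇔convexCombination : ∀ S p → Conv S p ⇔ ∃ (IsConvexCombination S p)
  Conv⇔convexCombination S (x , y) = mk⇔
    (λ (ws , ps , eW , eX , eY) → ws , ps ,
       trans (sym (cong proj₁ (sums ws))) eW ,
       trans (sym (cong (proj₁ ∘ proj₂) (sums ws))) eX ,
       trans (sym (cong (proj₂ ∘ proj₂) (sums ws))) eY)
    (λ (ws , ps , eW , eX , eY) → ws , ps ,
       trans (cong proj₁ (sums ws)) eW ,
       trans (cong (proj₁ ∘ proj₂) (sums ws)) eX ,
       trans (cong (proj₂ ∘ proj₂) (sums ws)) eY)
    where
    sums = convSums-≡ S x y

  linearForm : ℚ → ℚ → ℕ × ℕ → ℚ
  linearForm u v (a , b) = toℚ a * u + toℚ b * v

  moment-linearForm : ∀ u v ws →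
    moment (linearForm u v) ws ≡ moment abscissa ws * u + moment ordinate ws * v
  moment-linearForm u v [] = solve 2 (λ u v → con 0ℚ := con 0ℚ :* u :+ con 0ℚ :* v) refl u v
    where open +-*-Solver
  moment-linearForm u v (((a , b) , w) ∷ ws) rewrite moment-linearForm u v ws =
    solve 7 (λ w a b u v X Y → w :* (a :* u :+ b :* v) :+ (X :* u :+ Y :* v)
                               := (w :* a :+ X) :* u :+ (w :* b :+ Y) :* v)
      refl w (toℚ a) (toℚ b) u v (moment abscissa ws) (moment ordinate ws)
    where open +-*-Solver

  module _ {f : ℕ × ℕ → ℚ} {c : ℚ} where

    moment-≤ : ∀ ws → All (λ (p , w) → f p ≤ c × 0ℚ ≤ w) ws → moment f ws ≤ totalWeight ws * c
    moment-≤ [] [] = ≤-reflexive (sym (*-zeroˡ c))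
    moment-≤ ((p , w) ∷ ws) ((fp≤c , 0≤w) ∷ hs) = begin
      w * f p + moment f ws       ≤⟨ +-mono-≤ (*-monoˡ-≤-nonNeg w {{nonNegative 0≤w}} fp≤c) (moment-≤ ws hs) ⟩
      w * c + totalWeight ws * c  ≡⟨ *-distribʳ-+ c w (totalWeight ws) ⟨
      (w + totalWeight ws) * c    ∎
      where open ≤-Reasoning

    moment-≥ : ∀ ws → All (λ (p , w) → c ≤ f p × 0ℚ ≤ w) ws → totalWeight ws * c ≤ moment f ws
    moment-≥ [] [] = ≤-reflexive (*-zeroˡ c)
    moment-≥ ((p , w) ∷ ws) ((c≤fp , 0≤w) ∷ hs) = begin
      (w + totalWeight ws) * c    ≡⟨ *-distribʳ-+ c w (totalWeight ws) ⟩
      w * c + totalWeight ws * c  ≤⟨ +-mono-≤ (*-monoˡ-≤-nonNeg w {{nonNegative 0≤w}} c≤fp) (moment-≥ ws hs) ⟩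
      w * f p + moment f ws       ∎
      where open ≤-Reasoning

    moment-> : ∀ ws → All (λ (p , w) → c < f p × 0ℚ ≤ w) ws → 0ℚ < totalWeight ws →
               totalWeight ws * c < moment f ws
    moment-> [] [] 0<0 = contradiction 0<0 (<-irrefl refl)
    moment-> ((p , w) ∷ ws) ((c<fp , 0≤w) ∷ hs) 0<W with 0ℚ <? w
    ... | yes 0<w = begin-strict
      (w + totalWeight ws) * c    ≡⟨ *-distribʳ-+ c w (totalWeight ws) ⟩
      w * c + totalWeight ws * c  <⟨ +-mono-<-≤ (*-monoʳ-<-pos w {{positive 0<w}} c<fp) (moment-≥ ws c≤hs) ⟩
      w * f p + moment f ws       ∎
      where
      open ≤-Reasoning
      c≤hs = All.map (map₁ <⇒≤) hs
    ... | no 0≮w with refl ← ≤-antisym (≮⇒≥ 0≮w) 0≤w = begin-strict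
      (0ℚ + totalWeight ws) * c   ≡⟨ cong (_* c) (+-identityˡ (totalWeight ws)) ⟩
      totalWeight ws * c          <⟨ moment-> ws hs (subst (0ℚ <_) (+-identityˡ (totalWeight ws)) 0<W) ⟩
      moment f ws                 ≡⟨ +-identityˡ (moment f ws) ⟨
      0ℚ + moment f ws            ≡⟨ cong (_+ moment f ws) (*-zeroˡ (f p)) ⟨
      0ℚ * f p + moment f ws      ∎
      where open ≤-Reasoning

  module _ {S : ℕ × ℕ → Set} {u v c : ℚ} where

    conv-≤ : (∀ {p} → S p → linearForm u v p ≤ c) → ∀ {x y} → Conv S (x , y) → x * u + y * v ≤ c
    conv-≤ below conv
      with ws , ps , W≡1 , refl , refl ← Equivalence.to (Conv⇔convexCombination S _) conv = begin
      moment abscissa ws * u + moment ordinate ws * v  ≡⟨ moment-linearForm u v ws ⟨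
      moment (linearForm u v) ws                       ≤⟨ moment-≤ ws (All.map (map₁ below) ps) ⟩
      totalWeight ws * c                               ≡⟨ cong (_* c) W≡1 ⟩
      1ℚ * c                                           ≡⟨ *-identityˡ c ⟩
      c                                                ∎
      where open ≤-Reasoning

    conv-> : (∀ {p} → S p → c < linearForm u v p) → ∀ {x y} → Conv S (x , y) → c < x * u + y * v
    conv-> above conv
      with ws , ps , W≡1 , refl , refl ← Equivalence.to (Conv⇔convexCombination S _) conv = begin-strict
      c                                                ≡⟨ *-identityˡ c ⟨
      1ℚ * c                                           ≡⟨ cong (_* c) W≡1 ⟨
      totalWeight ws * c                               <⟨ moment-> ws (All.map (map₁ above) ps) 0<W ⟩
      moment (linearForm u v) ws                       ≡⟨ moment-linearForm u v ws ⟩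
      moment abscissa ws * u + moment ordinate ws * v  ∎
      where
      open ≤-Reasoning
      0<W = subst (0ℚ <_) (sym W≡1) (positive⁻¹ 1ℚ)

  triangular⇒hullsDisjoint : ∀ λs → Triangular λs → HullsDisjoint λs
  triangular⇒hullsDisjoint λs (r , s , r>0 , s>0 , H) _ inλ inλᶜ =
    <-irrefl refl (<-≤-trans (conv-> above inλᶜ) (conv-≤ below inλ))
    where
    instance
      _ = pos⇒nonZero r {{r>0}}
      _ = pos⇒nonZero s {{s>0}}
    below : ∀ {p} → InDiagram λs p → linearForm (1/ r) (1/ s) p ≤ 1ℚ
    below {a , b} p∈λ@(1≤a , 1≤b , _) = proj₁ (H a b 1≤a 1≤b) p∈λ
    above : ∀ {p} → InComplement λs p → 1ℚ < linearForm (1/ r) (1/ s) p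
    above {a , b} (1≤a , 1≤b , p∉λ) = ≰⇒> (λ le → p∉λ (proj₂ (H a b 1≤a 1≤b) le))

  triangular-fromLinearForm : ∀ λs u v .{{_ : Positive u}} .{{_ : Positive v}} →
    (∀ a b → 1 ℕ.≤ a → 1 ℕ.≤ b → InDiagram λs (a , b) ⇔ linearForm u v (a , b) ≤ 1ℚ) → Triangular λs
  triangular-fromLinearForm λs u v H = 1/ u , 1/ v , 1/pos⇒pos u , 1/pos⇒pos v , λ a b 1≤a 1≤b →
    (λ p∈λ → subst (_≤ 1ℚ) (sym (involution a b)) (Equivalence.to (H a b 1≤a 1≤b) p∈λ)) ,
    (λ le → Equivalence.from (H a b 1≤a 1≤b) (subst (_≤ 1ℚ) (involution a b) le))
    where
    instance
      _ = pos⇒nonZero u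
      _ = pos⇒nonZero v
      _ = pos⇒nonZero (1/ u) {{1/pos⇒pos u}}
      _ = pos⇒nonZero (1/ v) {{1/pos⇒pos v}}
    involution : ∀ a b → toℚ a * 1/ (1/ u) + toℚ b * 1/ (1/ v) ≡ linearForm u v (a , b)
    involution a b = cong₂ (λ u′ v′ → toℚ a * u′ + toℚ b * v′) (1/-involutive u) (1/-involutive v)

  module _ (C : ℕ) .{{_ : ℕ.NonZero C}} where
    private instance
      C>0 = toℚ-pos C
      C≥0 = toℚ-nonNeg C
      C≢0 = pos⇒nonZero (toℚ C)
      1/C>0 = 1/pos⇒pos (toℚ C)
      1/C≥0 = pos⇒nonNeg (1/ toℚ C)

    toℚ-ratio-≤-1 : ∀ n → toℚ n * 1/ toℚ C ≤ 1ℚ ⇔ n ℕ.≤ C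
    toℚ-ratio-≤-1 n = mk⇔
      (λ le → toℚ-cancel-≤ (begin
        toℚ n                       ≡⟨ *-identityʳ (toℚ n) ⟨
        toℚ n * 1ℚ                  ≡⟨ cong (toℚ n *_) (*-inverseˡ (toℚ C)) ⟨
        toℚ n * (1/ toℚ C * toℚ C)  ≡⟨ *-assoc (toℚ n) _ (toℚ C) ⟨
        toℚ n * 1/ toℚ C * toℚ C    ≤⟨ *-monoʳ-≤-nonNeg (toℚ C) le ⟩
        1ℚ * toℚ C                  ≡⟨ *-identityˡ (toℚ C) ⟩
        toℚ C                       ∎))
      (λ n≤C → begin
        toℚ n * 1/ toℚ C            ≤⟨ *-monoʳ-≤-nonNeg (1/ toℚ C) (toℚ-mono-≤ n≤C) ⟩
        toℚ C * 1/ toℚ C            ≡⟨ *-inverseʳ (toℚ C) ⟩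
        1ℚ                          ∎)
      where open ≤-Reasoning

    triangular-fromℕ : ∀ λs U V .{{_ : ℕ.NonZero U}} .{{_ : ℕ.NonZero V}} →
      (∀ a b → 1 ℕ.≤ a → 1 ℕ.≤ b → InDiagram λs (a , b) ⇔ U ℕ.* a ℕ.+ V ℕ.* b ℕ.≤ C) → Triangular λs
    triangular-fromℕ λs U V H = triangular-fromLinearForm λs u v {{u>0}} {{v>0}} description
      where
      u = toℚ U * 1/ toℚ C
      v = toℚ V * 1/ toℚ C
      u>0 = pos*pos⇒pos (toℚ U) {{toℚ-pos U}} (1/ toℚ C)
      v>0 = pos*pos⇒pos (toℚ V) {{toℚ-pos V}} (1/ toℚ C)
      scaled : ∀ a b → linearForm u v (a , b) ≡ toℚ (U ℕ.* a ℕ.+ V ℕ.* b) * 1/ toℚ C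
      scaled a b = begin
        toℚ a * (toℚ U * 1/ toℚ C) + toℚ b * (toℚ V * 1/ toℚ C)
          ≡⟨ solve 5 (λ a b U V c → a :* (U :* c) :+ b :* (V :* c) := (U :* a :+ V :* b) :* c) refl
               (toℚ a) (toℚ b) (toℚ U) (toℚ V) (1/ toℚ C) ⟩
        (toℚ U * toℚ a + toℚ V * toℚ b) * 1/ toℚ C
          ≡⟨ cong (_* 1/ toℚ C) (cong₂ _+_ (toℚ-* U a) (toℚ-* V b)) ⟨
        (toℚ (U ℕ.* a) + toℚ (V ℕ.* b)) * 1/ toℚ C
          ≡⟨ cong (_* 1/ toℚ C) (toℚ-+ (U ℕ.* a) (V ℕ.* b)) ⟨
        toℚ (U ℕ.* a ℕ.+ V ℕ.* b) * 1/ toℚ C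
          ∎
        where
        open ≡-Reasoning
        open +-*-Solver
      description : ∀ a b → 1 ℕ.≤ a → 1 ℕ.≤ b → InDiagram λs (a , b) ⇔ linearForm u v (a , b) ≤ 1ℚ
      description a b 1≤a 1≤b = subst (λ t → InDiagram λs (a , b) ⇔ t ≤ 1ℚ) (sym (scaled a b))
        (⇔-sym (toℚ-ratio-≤-1 _) ⇔-∘ H a b 1≤a 1≤b)

  ℕWeightedPoints : Set
  ℕWeightedPoints = List ((ℕ × ℕ) × ℕ)

  totalWeightℕ : ℕWeightedPoints → ℕ
  totalWeightℕ [] = 0
  totalWeightℕ ((_ , n) ∷ ps) = n ℕ.+ totalWeightℕ ps

  momentℕ : (ℕ × ℕ → ℕ) → ℕWeightedPoints → ℕ
  momentℕ f [] = 0
  momentℕ f ((p , n) ∷ ps) = n ℕ.* f p ℕ.+ momentℕ f ps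

  moments : ℕWeightedPoints → ℕ × ℕ × ℕ
  moments ps = totalWeightℕ ps , momentℕ proj₁ ps , momentℕ proj₂ ps

  rescale : ℚ → ℕWeightedPoints → WeightedPoints
  rescale q = map (λ (p , n) → p , toℚ n * q)

  totalWeight-rescale : ∀ q ps → totalWeight (rescale q ps) ≡ toℚ (totalWeightℕ ps) * q
  totalWeight-rescale q [] = sym (*-zeroˡ q)
  totalWeight-rescale q ((p , n) ∷ ps) = begin
    toℚ n * q + totalWeight (rescale q ps)  ≡⟨ cong (toℚ n * q +_) (totalWeight-rescale q ps) ⟩
    toℚ n * q + toℚ (totalWeightℕ ps) * q   ≡⟨ *-distribʳ-+ q (toℚ n) _ ⟨
    (toℚ n + toℚ (totalWeightℕ ps)) * q     ≡⟨ cong (_* q) (toℚ-+ n (totalWeightℕ ps)) ⟨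
    toℚ (n ℕ.+ totalWeightℕ ps) * q         ∎
    where open ≡-Reasoning

  moment-rescale : ∀ q f ps → moment (toℚ ∘ f) (rescale q ps) ≡ toℚ (momentℕ f ps) * q
  moment-rescale q f [] = sym (*-zeroˡ q)
  moment-rescale q f ((p , n) ∷ ps) = begin
    toℚ n * q * toℚ (f p) + moment (toℚ ∘ f) (rescale q ps)
      ≡⟨ cong (toℚ n * q * toℚ (f p) +_) (moment-rescale q f ps) ⟩
    toℚ n * q * toℚ (f p) + toℚ (momentℕ f ps) * q
      ≡⟨ solve 4 (λ n q x M → n :* q :* x :+ M :* q := (n :* x :+ M) :* q) refl
           (toℚ n) q (toℚ (f p)) (toℚ (momentℕ f ps)) ⟩
    (toℚ n * toℚ (f p) + toℚ (momentℕ f ps)) * q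
      ≡⟨ cong (λ t → (t + toℚ (momentℕ f ps)) * q) (toℚ-* n (f p)) ⟨
    (toℚ (n ℕ.* f p) + toℚ (momentℕ f ps)) * q
      ≡⟨ cong (_* q) (toℚ-+ (n ℕ.* f p) (momentℕ f ps)) ⟨
    toℚ (n ℕ.* f p ℕ.+ momentℕ f ps) * q
      ∎
    where
    open ≡-Reasoning
    open +-*-Solver

  conv-rescale : ∀ {S} ps → All (S ∘ proj₁) ps → ∀ q → .{{NonNegative q}} →
    toℚ (totalWeightℕ ps) * q ≡ 1ℚ → Conv S (toℚ (momentℕ proj₁ ps) * q , toℚ (momentℕ proj₂ ps) * q)
  conv-rescale {S} ps ps⊆S q Wq≡1 = Equivalence.from (Conv⇔convexCombination S _)
    ( rescale q ps
    , All.map⁺ (All.map (λ {(_ , n)} p∈S → p∈S , nonNegative⁻¹ _ {{weight≥0 n}}) ps⊆S)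
    , trans (totalWeight-rescale q ps) Wq≡1
    , moment-rescale q proj₁ ps
    , moment-rescale q proj₂ ps )
    where
    weight≥0 : ∀ n → NonNegative (toℚ n * q)
    weight≥0 n = nonNeg*nonNeg⇒nonNeg (toℚ n) {{toℚ-nonNeg n}} q

  equal-moments⇒hulls-meet : ∀ {S T} ps qs → All (S ∘ proj₁) ps → All (T ∘ proj₁) qs →
    1 ℕ.≤ totalWeightℕ ps → moments ps ≡ moments qs → ∃ λ p → Conv S p × Conv T p
  equal-moments⇒hulls-meet {T = T} ps qs ps⊆S qs⊆T 1≤W moments≡ =
    barycentre (moments ps) ,
    conv-rescale ps ps⊆S q (*-inverseʳ (toℚ W)) ,
    subst (Conv T) (cong barycentre (sym moments≡))
      (conv-rescale qs qs⊆T q (subst (λ W′ → toℚ W′ * q ≡ 1ℚ) (cong proj₁ moments≡) (*-inverseʳ (toℚ W))))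
    where
    W = totalWeightℕ ps
    instance
      _ = ℕ.>-nonZero 1≤W
      _ = toℚ-pos W
      _ = pos⇒nonZero (toℚ W)
      _ = pos⇒nonNeg (1/ toℚ W) {{1/pos⇒pos (toℚ W)}}
    q = 1/ toℚ W
    barycentre : ℕ × ℕ × ℕ → Point
    barycentre (_ , X , Y) = toℚ X * q , toℚ Y * q

module _ where
  open import Data.Nat
  open import Data.Nat.Properties
  open import Data.Nat.Tactic.RingSolver using (solve-∀)
  open import Algebra.Definitions using (Selective)
  open import Algebra.Properties.CommutativeSemigroup *-commutativeSemigroup using (xy∙z≈xz∙y)
  open import Data.List using (foldr; length; filter; applyUpTo; cartesianProduct)
  open import Data.List.Extrema.Nat using (max; ⊥≤max; xs≤max; max<v⁺)
  open import Data.List.Membership.Propositional using (_∈_)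
  open import Data.List.Membership.Propositional.Properties
  open import Data.List.Relation.Unary.Linked using (Linked; []; [-]; _∷_)
  open import Data.Product using (∃₂)
  open import Data.Sum using (inj₁; inj₂)
  import Relation.Unary as U
  open import Relation.Binary.Definitions using (Decidable; tri<; tri≈; tri>)

  part-step : ∀ {λs} → Linked _≥_ λs → ∀ {n} → 1 ≤ n → part λs (suc n) ≤ part λs n
  part-step [] _ = z≤n
  part-step [-] {suc n} _ = z≤n
  part-step (x≥y ∷ _) {1} _ = x≥y
  part-step (_ ∷ linked) {suc (suc n)} _ = part-step linked {suc n} (s≤s z≤n)

  part-antitone : ∀ {λs} → Linked _≥_ λs → ∀ {i j} → 1 ≤ i → i ≤ j → part λs j ≤ part λs i
  part-antitone linked 1≤i i≤j with m≤n⇒m<n∨m≡n i≤j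
  ... | inj₂ refl = ≤-refl
  ... | inj₁ (s≤s i≤j′) = ≤-trans (part-step linked (≤-trans 1≤i i≤j′)) (part-antitone linked 1≤i i≤j′)

  part-beyond : ∀ λs {i} → length λs < i → part λs i ≡ 0
  part-beyond [] {suc i} _ = refl
  part-beyond (x ∷ xs) {suc (suc i)} (s≤s i>) = part-beyond xs i>

  part-positive : ∀ {λs} → All (1 ≤_) λs → ∀ {i} → 1 ≤ i → i ≤ length λs → 1 ≤ part λs i
  part-positive (1≤x ∷ _) {1} _ _ = 1≤x
  part-positive (_ ∷ 1≤xs) {suc (suc i)} _ (s≤s i≤) = part-positive 1≤xs (s≤s z≤n) i≤

  part-positive⇒≤length : ∀ λs {i} → 1 ≤ part λs i → i ≤ length λs
  part-positive⇒≤length λs {i} 1≤part with i ≤? length λs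
  ... | yes i≤ = i≤
  ... | no i≰ = contradiction (part-beyond λs (≰⇒> i≰)) (≢-sym (<⇒≢ 1≤part))

  complement-upward : ∀ {λs} → Linked _≥_ λs →
    ∀ {a b c} → InComplement λs (a , b) → b ≤ c → InComplement λs (a , c)
  complement-upward linked (1≤a , 1≤b , a∉) b≤c =
    1≤a , ≤-trans 1≤b b≤c , λ (_ , _ , a≤) → a∉ (1≤a , 1≤b , ≤-trans a≤ (part-antitone linked 1≤b b≤c))

  rows : ℕ → List ℕ
  rows n = applyUpTo suc n

  ∈-rows⁺ : ∀ {i n} → 1 ≤ i → i ≤ n → i ∈ rows n
  ∈-rows⁺ {suc i} _ i<n = ∈-applyUpTo⁺ suc i<n

  ∈-rows⁻ : ∀ {i n} → i ∈ rows n → 1 ≤ i × i ≤ n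
  ∈-rows⁻ i∈ with _ , i<n , refl ← ∈-applyUpTo⁻ suc i∈ = s≤s z≤n , i<n

  innerCorner outerCorner : List ℕ → ℕ → ℕ × ℕ
  innerCorner λs i = part λs i , i
  outerCorner λs j = suc (part λs j) , j

  innerCorner-∈ : ∀ {λs} → IsPartition λs → ∀ {i} → 1 ≤ i → i ≤ length λs →
    InDiagram λs (innerCorner λs i)
  innerCorner-∈ (positive , _) 1≤i i≤ = part-positive positive 1≤i i≤ , 1≤i , ≤-refl

  outerCorner-∉ : ∀ {λs j} → 1 ≤ j → InComplement λs (outerCorner λs j)
  outerCorner-∉ 1≤j = s≤s z≤n , 1≤j , λ (_ , _ , 1+p≤p) → 1+n≰n 1+p≤p

  linearFormℕ : ℕ → ℕ → ℕ × ℕ → ℕ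
  linearFormℕ U V (a , b) = U * a + V * b

  CornersSeparated : List ℕ → ℕ → ℕ → Set
  CornersSeparated λs U V = ∀ {i j} → 1 ≤ i → i ≤ length λs → 1 ≤ j → j ≤ suc (length λs) →
    linearFormℕ U V (innerCorner λs i) < linearFormℕ U V (outerCorner λs j)

  cornersSeparated⇒linearDescription : ∀ λs U V → 1 ≤ U → 1 ≤ V → CornersSeparated λs U V →
    ∃ λ C → 1 ≤ C × (∀ a b → 1 ≤ a → 1 ≤ b → InDiagram λs (a , b) ⇔ linearFormℕ U V (a , b) ≤ C)
  cornersSeparated⇒linearDescription λs U V 1≤U 1≤V separated =
    C , ⊥≤max 1 innerValues , λ a b 1≤a 1≤b → mk⇔ (below 1≤a 1≤b) (above 1≤a 1≤b)
    where
    K = length λs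
    innerValues = map (linearFormℕ U V ∘ innerCorner λs) (rows K)
    -- Starting the maximum at 1 rather than 0 keeps C positive when λ is empty; 1 is still
    -- below every outer corner because U, V ≥ 1.
    C = max 1 innerValues

    outer-mono : ∀ {j} → suc K ≤ j →
      linearFormℕ U V (outerCorner λs (suc K)) ≤ linearFormℕ U V (outerCorner λs j)
    outer-mono {j} K<j rewrite part-beyond λs (n<1+n K) | part-beyond λs K<j =
      +-monoʳ-≤ (U * 1) (*-monoʳ-≤ V K<j)

    inner<outer : ∀ {i j} → 1 ≤ i → i ≤ K → 1 ≤ j →
      linearFormℕ U V (innerCorner λs i) < linearFormℕ U V (outerCorner λs j)
    inner<outer {j = j} 1≤i i≤K 1≤j with j ≤? suc K
    ... | yes j≤ = separated 1≤i i≤K 1≤j j≤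
    ... | no j≰ = <-≤-trans (separated 1≤i i≤K (s≤s z≤n) ≤-refl) (outer-mono (≤-trans (n≤1+n _) (≰⇒> j≰)))

    inner≤C : ∀ {i} → 1 ≤ i → i ≤ K → linearFormℕ U V (innerCorner λs i) ≤ C
    inner≤C 1≤i i≤K =
      All.lookup (xs≤max 1 innerValues) (∈-map⁺ (linearFormℕ U V ∘ innerCorner λs) (∈-rows⁺ 1≤i i≤K))

    C<outer : ∀ {j} → 1 ≤ j → C < linearFormℕ U V (outerCorner λs j)
    C<outer 1≤j = max<v⁺ (+-mono-≤ (*-mono-≤ 1≤U (s≤s z≤n)) (*-mono-≤ 1≤V 1≤j))
      (All.map⁺ (All.applyUpTo⁺₁ suc K λ i<K → inner<outer (s≤s z≤n) i<K 1≤j))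

    below : ∀ {a b} → 1 ≤ a → 1 ≤ b → InDiagram λs (a , b) → linearFormℕ U V (a , b) ≤ C
    below {a} {b} 1≤a 1≤b (_ , _ , a≤p) = ≤-trans (+-monoˡ-≤ (V * b) (*-monoʳ-≤ U a≤p))
      (inner≤C 1≤b (part-positive⇒≤length λs (≤-trans 1≤a a≤p)))

    above : ∀ {a b} → 1 ≤ a → 1 ≤ b → linearFormℕ U V (a , b) ≤ C → InDiagram λs (a , b)
    above {a} {b} 1≤a 1≤b ≤C with a ≤? part λs b
    ... | yes a≤p = 1≤a , 1≤b , a≤p
    ... | no a≰p = contradiction (≤-trans (+-monoˡ-≤ (V * b) (*-monoʳ-≤ U (≰⇒> a≰p))) ≤C) (<⇒≱ (C<outer 1≤b))

  Fraction : Set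
  Fraction = ℕ × ℕ

  HasPositiveDenominator : Fraction → Set
  HasPositiveDenominator (_ , n) = 1 ≤ n

  infix 4 _≤ᶠ_ _<ᶠ_
  infixl 6 _⊔ᶠ_

  _≤ᶠ_ _<ᶠ_ : Fraction → Fraction → Set
  (m , n) ≤ᶠ (m′ , n′) = m * n′ ≤ m′ * n
  (m , n) <ᶠ (m′ , n′) = m * n′ < m′ * n

  _<ᶠ?_ : Decidable _<ᶠ_
  (m , n) <ᶠ? (m′ , n′) = m * n′ <? m′ * n

  ProductBelowOne : Fraction → Fraction → Set
  ProductBelowOne (m , n) (m′ , n′) = m * m′ < n * n′

  ≤ᶠ-trans : ∀ {x y z} → HasPositiveDenominator y → x ≤ᶠ y → y ≤ᶠ z → x ≤ᶠ z
  ≤ᶠ-trans {m , n} {k , l} {m′ , n′} 1≤l mn≤kl kl≤m′n′ =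
    *-cancelʳ-≤ (m * n′) (m′ * n) l {{>-nonZero 1≤l}} (begin
      m * n′ * l  ≡⟨ xy∙z≈xz∙y m n′ l ⟩
      m * l * n′  ≤⟨ *-monoˡ-≤ n′ mn≤kl ⟩
      k * n * n′  ≡⟨ xy∙z≈xz∙y k n n′ ⟩
      k * n′ * n  ≤⟨ *-monoˡ-≤ n kl≤m′n′ ⟩
      m′ * l * n  ≡⟨ xy∙z≈xz∙y m′ l n ⟩
      m′ * n * l  ∎)
    where open ≤-Reasoning

  ≤-<ᶠ-trans : ∀ {x y z} → HasPositiveDenominator x → HasPositiveDenominator y → x ≤ᶠ y → y <ᶠ z → x <ᶠ z
  ≤-<ᶠ-trans {m , n} {k , l} {m′ , n′} 1≤n 1≤l mn≤kl kl<m′n′ =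
    *-cancelʳ-< l (m * n′) (m′ * n) (begin-strict
      m * n′ * l  ≡⟨ xy∙z≈xz∙y m n′ l ⟩
      m * l * n′  ≤⟨ *-monoˡ-≤ n′ mn≤kl ⟩
      k * n * n′  ≡⟨ xy∙z≈xz∙y k n n′ ⟩
      k * n′ * n  <⟨ *-monoˡ-< n {{>-nonZero 1≤n}} kl<m′n′ ⟩
      m′ * l * n  ≡⟨ xy∙z≈xz∙y m′ l n ⟩
      m′ * n * l  ∎)
    where open ≤-Reasoning

  _⊔ᶠ_ : Fraction → Fraction → Fraction
  x ⊔ᶠ y with x <ᶠ? y
  ... | yes _ = y
  ... | no _ = x

  ⊔ᶠ-sel : Selective _≡_ _⊔ᶠ_
  ⊔ᶠ-sel x y with x <ᶠ? y
  ... | yes _ = inj₂ refl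
  ... | no _ = inj₁ refl

  x≤ᶠx⊔ᶠy : ∀ x y → x ≤ᶠ x ⊔ᶠ y
  x≤ᶠx⊔ᶠy x y with x <ᶠ? y
  ... | yes x<y = <⇒≤ x<y
  ... | no _ = ≤-refl

  y≤ᶠx⊔ᶠy : ∀ x y → y ≤ᶠ x ⊔ᶠ y
  y≤ᶠx⊔ᶠy x y with x <ᶠ? y
  ... | yes _ = ≤-refl
  ... | no x≮y = ≮⇒≥ x≮y

  maxᶠ : List Fraction → Fraction
  maxᶠ = foldr _⊔ᶠ_ (0 , 1)

  maxᶠ-all : ∀ {P : Fraction → Set} {xs} → P (0 , 1) → All P xs → P (maxᶠ xs)
  maxᶠ-all {P} {xs} p₀ pxs with foldr-selective ⊔ᶠ-sel (0 , 1) xs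
  ... | inj₁ max≡0 = subst P (sym max≡0) p₀
  ... | inj₂ max∈xs = All.lookup pxs max∈xs

  xs≤ᶠmaxᶠ : ∀ xs → All HasPositiveDenominator xs → All (_≤ᶠ maxᶠ xs) xs
  xs≤ᶠmaxᶠ [] [] = []
  xs≤ᶠmaxᶠ (x ∷ xs) (_ ∷ positive) =
    x≤ᶠx⊔ᶠy x (maxᶠ xs) ∷ All.map (λ {y} → through-max {y}) (xs≤ᶠmaxᶠ xs positive)
    where
    through-max : ∀ {y} → y ≤ᶠ maxᶠ xs → y ≤ᶠ x ⊔ᶠ maxᶠ xs
    through-max {y} y≤max = ≤ᶠ-trans {y} {maxᶠ xs} {x ⊔ᶠ maxᶠ xs}
      (maxᶠ-all (s≤s z≤n) positive) y≤max (y≤ᶠx⊔ᶠy x (maxᶠ xs))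

  mediant-above : ∀ {x y} → ProductBelowOne x y → x <ᶠ (proj₁ x + proj₂ y , proj₂ x + proj₁ y)
  mediant-above {γ , δ} {β , α} γβ<δα = begin-strict
    γ * (δ + β)    ≡⟨ *-distribˡ-+ γ δ β ⟩
    γ * δ + γ * β  <⟨ +-monoʳ-< (γ * δ) γβ<δα ⟩
    γ * δ + δ * α  ≡⟨ cong (γ * δ +_) (*-comm δ α) ⟩
    γ * δ + α * δ  ≡⟨ *-distribʳ-+ δ γ α ⟨
    (γ + α) * δ    ∎
    where open ≤-Reasoning

  separating-ratio : ∀ xs ys → All HasPositiveDenominator xs → All HasPositiveDenominator ys →
    All (λ x → All (ProductBelowOne x) ys) xs →
    ∃₂ λ U V → 1 ≤ U × 1 ≤ V × All (_<ᶠ (V , U)) xs × All (_<ᶠ (U , V)) ys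
  separating-ratio xs ys xs-positive ys-positive compatible =
    U , V , ≤-trans 1≤δ (m≤m+n δ β) , ≤-trans 1≤α (m≤n+m α γ) ,
    All.zipWith (λ {x} (1≤n , x≤max) → ≤-<ᶠ-trans {x} {maxᶠ xs} {V , U} 1≤n 1≤δ x≤max max-xs-below)
      (xs-positive , xs≤ᶠmaxᶠ xs xs-positive) ,
    All.zipWith (λ {y} (1≤n , y≤max) → ≤-<ᶠ-trans {y} {maxᶠ ys} {U , V} 1≤n 1≤α y≤max max-ys-below)
      (ys-positive , xs≤ᶠmaxᶠ ys ys-positive)
    where
    γ = proj₁ (maxᶠ xs)
    δ = proj₂ (maxᶠ xs)
    β = proj₁ (maxᶠ ys)
    α = proj₂ (maxᶠ ys)
    U = δ + β
    V = γ + α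
    1≤δ : 1 ≤ δ
    1≤δ = maxᶠ-all (s≤s z≤n) xs-positive
    1≤α : 1 ≤ α
    1≤α = maxᶠ-all (s≤s z≤n) ys-positive
    max-compatible : ProductBelowOne (maxᶠ xs) (maxᶠ ys)
    max-compatible = maxᶠ-all {P = ProductBelowOne (maxᶠ xs)}
      (subst₂ _<_ (sym (*-zeroʳ γ)) (sym (*-identityʳ δ)) 1≤δ)
      (maxᶠ-all {P = λ x → All (ProductBelowOne x) ys}
        (All.map (λ {(_ , n)} 1≤n → subst (0 <_) (sym (+-identityʳ n)) 1≤n) ys-positive) compatible)
    max-xs-below : maxᶠ xs <ᶠ (V , U)
    max-xs-below = mediant-above {maxᶠ xs} {maxᶠ ys} max-compatible
    max-ys-below : maxᶠ ys <ᶠ (U , V)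
    max-ys-below = subst₂ (λ u v → β * v < u * α) (+-comm β δ) (+-comm α γ)
      (mediant-above {maxᶠ ys} {maxᶠ xs} (subst₂ _<_ (*-comm γ β) (*-comm δ α) max-compatible))

  -- (γ + 1) A + α B = γ P + (P + (0 , D)) + α Q with D = (γ + 1) β − δ α ≥ 0, and the cell
  -- P + (0 , D) lies in T because T is closed upwards.
  crossing⇒hulls-meet : ∀ {S T : ℕ × ℕ → Set} → (∀ {a b c} → T (a , b) → b ≤ c → T (a , c)) →
    ∀ {a₁ a₂ b₁ b₂ p₁ p₂ q₁ q₂} α β γ δ →
    S (a₁ , a₂) → T (p₁ , p₂) → S (b₁ , b₂) → T (q₁ , q₂) →
    a₁ + α ≡ p₁ → p₂ + β ≡ a₂ → q₁ + suc γ ≡ b₁ → b₂ + δ ≡ q₂ → δ * α ≤ suc γ * β →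
    ∃ λ p → Conv S p × Conv T p
  crossing⇒hulls-meet upward {a₁} {b₂ = b₂} {p₂ = p₂} {q₁ = q₁} α β γ δ A∈S P∈T B∈S Q∈T
    refl refl refl refl δα≤γβ =
    equal-moments⇒hulls-meet
      (((a₁ , p₂ + β) , suc γ) ∷ ((q₁ + suc γ , b₂) , α) ∷ [])
      (((a₁ + α , p₂) , γ) ∷ ((a₁ + α , p₂ + D) , 1) ∷ ((q₁ , b₂ + δ) , α) ∷ [])
      (A∈S ∷ B∈S ∷ []) (P∈T ∷ upward P∈T (m≤m+n p₂ D) ∷ Q∈T ∷ [])
      (s≤s z≤n) (cong₂ _,_ (weights γ α) (cong₂ _,_ (abscissae γ a₁ α q₁) ordinates))
    where
    D = suc γ * β ∸ δ * α
    weights : ∀ γ α → suc γ + (α + 0) ≡ γ + (1 + (α + 0))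
    weights = solve-∀
    abscissae : ∀ γ a α q → suc γ * a + (α * (q + suc γ) + 0) ≡ γ * (a + α) + (1 * (a + α) + (α * q + 0))
    abscissae = solve-∀
    ordinates : suc γ * (p₂ + β) + (α * b₂ + 0) ≡ γ * p₂ + (1 * (p₂ + D) + (α * (b₂ + δ) + 0))
    ordinates = begin
      suc γ * (p₂ + β) + (α * b₂ + 0)               ≡⟨ regroup γ p₂ β α b₂ ⟩
      suc γ * p₂ + α * b₂ + suc γ * β               ≡⟨ cong (suc γ * p₂ + α * b₂ +_) (m∸n+n≡m δα≤γβ) ⟨
      suc γ * p₂ + α * b₂ + (D + δ * α)             ≡⟨ spread γ p₂ α b₂ D δ ⟩
      γ * p₂ + (1 * (p₂ + D) + (α * (b₂ + δ) + 0))  ∎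
      where
      open ≡-Reasoning
      regroup : ∀ γ p β α b → suc γ * (p + β) + (α * b + 0) ≡ suc γ * p + α * b + suc γ * β
      regroup = solve-∀
      spread : ∀ γ p α b D δ → suc γ * p + α * b + (D + δ * α) ≡ γ * p + (1 * (p + D) + (α * (b + δ) + 0))
      spread = solve-∀

  linearFormℕ-<-ascent : ∀ U V {p q i j γ δ} → γ * U < V * δ → p ≤ q + γ → i + δ ≡ j →
    linearFormℕ U V (p , i) < linearFormℕ U V (q , j)
  linearFormℕ-<-ascent U V {p} {q} {i} {j} {γ} {δ} γU<Vδ p≤q+γ refl = begin-strict
    U * p + V * i          ≤⟨ +-monoˡ-≤ (V * i) (*-monoʳ-≤ U p≤q+γ) ⟩
    U * (q + γ) + V * i    ≡⟨ regroup U q γ V i ⟩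
    U * q + V * i + γ * U  <⟨ +-monoʳ-< (U * q + V * i) γU<Vδ ⟩
    U * q + V * i + V * δ  ≡⟨ distribute U q V i δ ⟩
    U * q + V * (i + δ)    ∎
    where
    open ≤-Reasoning
    regroup : ∀ U q γ V i → U * (q + γ) + V * i ≡ U * q + V * i + γ * U
    regroup = solve-∀
    distribute : ∀ U q V i δ → U * q + V * i + V * δ ≡ U * q + V * (i + δ)
    distribute = solve-∀

  linearFormℕ-<-descent : ∀ U V {p q i j α β} → β * V < U * α → p + α ≡ q → j + β ≡ i →
    linearFormℕ U V (p , i) < linearFormℕ U V (q , j)
  linearFormℕ-<-descent U V {p} {q} {i} {j} {α} {β} βV<Uα refl refl = begin-strict
    U * p + V * (j + β)    ≡⟨ regroup U p V j β ⟩
    U * p + V * j + β * V  <⟨ +-monoʳ-< (U * p + V * j) βV<Uα ⟩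
    U * p + V * j + U * α  ≡⟨ distribute U p V j α ⟩
    U * (p + α) + V * j    ∎
    where
    open ≤-Reasoning
    regroup : ∀ U p V j β → U * p + V * (j + β) ≡ U * p + V * j + β * V
    regroup = solve-∀
    distribute : ∀ U p V j α → U * p + V * j + U * α ≡ U * (p + α) + V * j
    distribute = solve-∀

  cornerPairs : List ℕ → List (ℕ × ℕ)
  cornerPairs λs = cartesianProduct (rows (length λs)) (rows (suc (length λs)))

  ∈-cornerPairs⁺ : ∀ {λs i j} → 1 ≤ i → i ≤ length λs → 1 ≤ j → j ≤ suc (length λs) →
    (i , j) ∈ cornerPairs λs
  ∈-cornerPairs⁺ 1≤i i≤K 1≤j j≤K+1 = ∈-cartesianProduct⁺ (∈-rows⁺ 1≤i i≤K) (∈-rows⁺ 1≤j j≤K+1)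

  ∈-cornerPairs⁻ : ∀ {λs i j} → (i , j) ∈ cornerPairs λs →
    (1 ≤ i × i ≤ length λs) × (1 ≤ j × j ≤ suc (length λs))
  ∈-cornerPairs⁻ ij∈ with i∈ , j∈ ← ∈-cartesianProduct⁻ _ _ ij∈ = ∈-rows⁻ i∈ , ∈-rows⁻ j∈

  Ascent Descent : ℕ × ℕ → Set
  Ascent (i , j) = i < j
  Descent (i , j) = j < i

  ascent? : U.Decidable Ascent
  ascent? (i , j) = i <? j

  descent? : U.Decidable Descent
  descent? (i , j) = j <? i

  ascents descents : List ℕ → List (ℕ × ℕ)
  ascents λs = filter ascent? (cornerPairs λs)
  descents λs = filter descent? (cornerPairs λs)

  -- U λ_i + V i < U (λ_j + 1) + V j reads (λ_i − λ_j − 1)/(j − i) < V/U on an ascent and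
  -- (i − j)/(λ_j + 1 − λ_i) < U/V on a descent. Truncated subtraction turns an ascent bound
  -- into 0/(j − i), satisfied by all U, V, exactly when λ_i ≤ λ_j + 1.
  ascentBound descentBound : List ℕ → ℕ × ℕ → Fraction
  ascentBound λs (i , j) = part λs i ∸ suc (part λs j) , j ∸ i
  descentBound λs (i , j) = i ∸ j , suc (part λs j) ∸ part λs i

  ascentBounds descentBounds : List ℕ → List Fraction
  ascentBounds λs = map (ascentBound λs) (ascents λs)
  descentBounds λs = map (descentBound λs) (descents λs)

  ascentBounds-positive : ∀ λs → All HasPositiveDenominator (ascentBounds λs)
  ascentBounds-positive λs =
    All.map⁺ (All.tabulate λ ij∈ → m<n⇒0<n∸m (proj₂ (∈-filter⁻ ascent? {xs = cornerPairs λs} ij∈)))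

  descentBounds-positive : ∀ {λs} → Linked _≥_ λs → All HasPositiveDenominator (descentBounds λs)
  descentBounds-positive {λs} linked = All.map⁺ (All.tabulate positive)
    where
    positive : ∀ {ij} → ij ∈ descents λs → HasPositiveDenominator (descentBound λs ij)
    positive ij∈ with ij∈pairs , j<i ← ∈-filter⁻ descent? {xs = cornerPairs λs} ij∈
      with _ , (1≤j , _) ← ∈-cornerPairs⁻ {λs} ij∈pairs =
      m<n⇒0<n∸m (s≤s (part-antitone linked 1≤j (<⇒≤ j<i)))

  bounds⇒cornersSeparated : ∀ {λs U V} → Linked _≥_ λs → 1 ≤ U →
    All (_<ᶠ (V , U)) (ascentBounds λs) → All (_<ᶠ (U , V)) (descentBounds λs) → CornersSeparated λs U V
  bounds⇒cornersSeparated {λs} {U} {V} linked 1≤U below above {i} {j} 1≤i i≤K 1≤j j≤K+1 with <-cmp i j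
  ... | tri< i<j _ _ = linearFormℕ-<-ascent U V
    (All.lookup (All.map⁻ below) (∈-filter⁺ ascent? (∈-cornerPairs⁺ {λs} 1≤i i≤K 1≤j j≤K+1) i<j))
    (m≤n+m∸n (part λs i) (suc (part λs j))) (m+[n∸m]≡n (<⇒≤ i<j))
  ... | tri≈ _ refl _ = +-monoˡ-< (V * i) (*-monoʳ-< U {{>-nonZero 1≤U}} (n<1+n (part λs i)))
  ... | tri> _ _ j<i = linearFormℕ-<-descent U V
    (All.lookup (All.map⁻ above) (∈-filter⁺ descent? (∈-cornerPairs⁺ {λs} 1≤i i≤K 1≤j j≤K+1) j<i))
    (m+[n∸m]≡n (≤-trans (part-antitone linked 1≤j (<⇒≤ j<i)) (n≤1+n _))) (m+[n∸m]≡n (<⇒≤ j<i))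

  incompatible-bounds⇒hulls-meet : ∀ {λs} → IsPartition λs → ∀ {i j i′ j′ γ} →
    1 ≤ i → i ≤ length λs → Ascent (i , j) → 1 ≤ j′ → Descent (i′ , j′) → i′ ≤ length λs →
    part λs i ∸ suc (part λs j) ≡ suc γ → (j ∸ i) * (suc (part λs j′) ∸ part λs i′) ≤ suc γ * (i′ ∸ j′) →
    ∃ λ p → Conv (InDiagram λs) p × Conv (InComplement λs) p
  incompatible-bounds⇒hulls-meet {λs} P@(_ , linked) {i} {j} {i′} {j′} {γ} 1≤i i≤K i<j 1≤j′ j′<i′ i′≤K γ-eq =
    crossing⇒hulls-meet (complement-upward linked) (suc (part λs j′) ∸ part λs i′) (i′ ∸ j′) γ (j ∸ i)
      (innerCorner-∈ P (≤-trans 1≤j′ (<⇒≤ j′<i′)) i′≤K) (outerCorner-∉ 1≤j′)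
      (innerCorner-∈ P 1≤i i≤K) (outerCorner-∉ (≤-trans 1≤i (<⇒≤ i<j)))
      (m+[n∸m]≡n (≤-trans (part-antitone linked 1≤j′ (<⇒≤ j′<i′)) (n≤1+n _)))
      (m+[n∸m]≡n (<⇒≤ j′<i′))
      (trans (cong (suc (part λs j) +_) (sym γ-eq)) (m+[n∸m]≡n 1+pj≤pi))
      (m+[n∸m]≡n (<⇒≤ i<j))
    where
    1+pj≤pi : suc (part λs j) ≤ part λs i
    1+pj≤pi = <⇒≤ (m∸n≢0⇒n<m (λ γ≡0 → 0≢1+n (trans (sym γ≡0) γ-eq)))

  ascent-descent-compatible : ∀ {λs} → IsPartition λs → HullsDisjoint λs → ∀ {i j i′ j′} →
    1 ≤ i → i ≤ length λs → Ascent (i , j) → 1 ≤ j′ → Descent (i′ , j′) → i′ ≤ length λs →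
    ProductBelowOne (ascentBound λs (i , j)) (descentBound λs (i′ , j′))
  ascent-descent-compatible {λs} P@(_ , linked) disjoint {i} {j} {i′} {j′} 1≤i i≤K i<j 1≤j′ j′<i′ i′≤K
    with part λs i ∸ suc (part λs j) in γ-eq
  ... | zero = *-mono-≤ (m<n⇒0<n∸m i<j) (m<n⇒0<n∸m (s≤s (part-antitone linked 1≤j′ (<⇒≤ j′<i′))))
  ... | suc γ with suc γ * (i′ ∸ j′) <? (j ∸ i) * (suc (part λs j′) ∸ part λs i′)
  ...   | yes below = below
  ...   | no not-below
    with p , inλ , inλᶜ
           ← incompatible-bounds⇒hulls-meet P 1≤i i≤K i<j 1≤j′ j′<i′ i′≤K γ-eq (≮⇒≥ not-below)
    = contradiction inλᶜ (disjoint p inλ)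

  bounds-compatible : ∀ {λs} → IsPartition λs → HullsDisjoint λs →
    All (λ x → All (ProductBelowOne x) (descentBounds λs)) (ascentBounds λs)
  bounds-compatible {λs} P disjoint =
    All.map⁺ (All.tabulate λ ij∈ → All.map⁺ (All.tabulate λ i′j′∈ → compatible ij∈ i′j′∈))
    where
    compatible : ∀ {ij i′j′} → ij ∈ ascents λs → i′j′ ∈ descents λs →
      ProductBelowOne (ascentBound λs ij) (descentBound λs i′j′)
    compatible ij∈ i′j′∈
      with ij∈pairs , i<j ← ∈-filter⁻ ascent? {xs = cornerPairs λs} ij∈
         | i′j′∈pairs , j′<i′ ← ∈-filter⁻ descent? {xs = cornerPairs λs} i′j′∈
      with (1≤i , i≤K) , _ ← ∈-cornerPairs⁻ {λs} ij∈pairs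
         | (_ , i′≤K) , (1≤j′ , _) ← ∈-cornerPairs⁻ {λs} i′j′∈pairs
      = ascent-descent-compatible P disjoint 1≤i i≤K i<j 1≤j′ j′<i′ i′≤K

  hullsDisjoint⇒triangular : ∀ λs → IsPartition λs → HullsDisjoint λs → Triangular λs
  hullsDisjoint⇒triangular λs P@(_ , linked) disjoint
    with U , V , 1≤U , 1≤V , ascentBounds-below , descentBounds-below
           ← separating-ratio (ascentBounds λs) (descentBounds λs)
               (ascentBounds-positive λs) (descentBounds-positive linked) (bounds-compatible P disjoint)
    with C , 1≤C , description
           ← cornersSeparated⇒linearDescription λs U V 1≤U 1≤V
               (bounds⇒cornersSeparated linked 1≤U ascentBounds-below descentBounds-below)
    = triangular-fromℕ C {{>-nonZero 1≤C}} λs U V {{>-nonZero 1≤U}} {{>-nonZero 1≤V}} description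

proposition3p1 : (λs : List ℕ) → IsPartition λs → Triangular λs ⇔ HullsDisjoint λs
proposition3p1 λs P = mk⇔ (triangular⇒hullsDisjoint λs) (hullsDisjoint⇒triangular λs P)
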